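{- Let $c$ be a positive integer and let $G=(A,B,E)$ be the complete bipartite graph with $|A|=n$ and $|B|=(c!)^{\frac{1}{c+1}}n^{\frac{1}{c+1}}$ (in particular this number is an integer). Let $E'\subseteq E$ be an arbitrary subset such that $\deg_{E'}(a)\le c$ for all $a\in A$. Then there exists $A'\subseteq A$ with $|A'|\le|B|$ and $$\operatorname{deg}_{\max}\mathrm{semi}(A',B,E')\ge\frac{(c!)^{\frac{1}{c+1}}}{c}\,n^{\frac{1}{c+1}}>e^{ -1.3}n^{\frac{1}{c+1}}.$$
   Context: $\deg_F(v)$ is the number of edges of $F$ at $v$; $\operatorname{deg}_{\max}F=\max_v\deg_F(v)$. For $X\subseteq A$ and $F\subseteq E$, a semi-matching of $(X,B,F)$ is a set $T$ of edges of $F$ between $X$ and $B$ with $\deg_T(a)=1$ for all $a\in X$; a degree-minimizing path with respect to $T$ is a path $b_1,a_1,b_2,\dots,a_{k-1},b_k$ ($a_i\in X$) with $(a_i,b_i)\in T$, $(a_i,b_{i+1})\in F\setminus T$, $\deg_T(b_1)\ge\deg_T(b_k)+2$; $\mathrm{semi}(X,B,F)$ denotes an optimal semi-matching (none such path), all of which share the same maximum degree, equal to the minimum maximum degree over all semi-matchings of $(X,B,F)$. If $(X,B,F)$ has no semi-matching (some vertex of $X$ has no incident edge of $F$), $\operatorname{deg}_{\max}\mathrm{semi}(X,B,F)$ is taken to be $+\infty$. -}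

module Defs where

open import Data.Nat using (ℕ; zero; suc; _+_; _*_; _^_; _≤_; _<_; _⊔_)
open import Data.Nat.Base using (_!)
open import Data.Fin using (Fin)
open import Data.Fin.Subset using (Subset; _∈_; ∣_∣)
open import Data.Fin.Subset.Properties using (_∈?_)
open import Relation.Nullary using (_×-dec_)
open import Data.Fin.Properties using (_≟_)
open import Data.List using (List; foldr; map; allFin; filter; length)
open import Data.Product using (Σ; _×_; _,_; proj₁)
open import Relation.Binary.PropositionalEquality using (_≡_)

-- Bipartite graph with A = Fin n, B = Fin m.  An edge set F ⊆ A × B is given
-- by neighbourhoods  F : Fin n → Subset m  ((a,b) ∈ F  iff  b ∈ F a).

degA : ∀ {n m} → (Fin n → Subset m) → Fin n → ℕ
degA F a = ∣ F a ∣

-- A semi-matching T of (X, B, F), X ⊆ A: every a ∈ X has exactly one T-edge,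
-- so T is described by the choice  t a  of the B-endpoint of that edge,
-- which must be an F-edge.  (Values of t outside X are irrelevant.)
SemiMatching : ∀ {n m} → Subset n → (Fin n → Subset m) → Set
SemiMatching {n} {m} X F =
  Σ (Fin n → Fin m) λ t → ∀ (a : Fin n) → a ∈ X → t a ∈ F a

degT : ∀ {n m} {X : Subset n} {F : Fin n → Subset m} →
       SemiMatching X F → Fin m → ℕ
degT {n} {m} {X} T b =
  length (filter (λ a → (a ∈? X) ×-dec (proj₁ T a ≟ b)) (allFin n))

degMax : ∀ {n m} {X : Subset n} {F : Fin n → Subset m} →
         SemiMatching X F → ℕ
degMax {n} {m} T = foldr _⊔_ 0 (map (degT T) (allFin m))

-- Scaled partial sums of the exponential series:
--   expPS y K = 10^K · K! · Σ_{k=0}^{K} (y/10)^k / k!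
-- via  expPS y 0 = 1,  expPS y (K+1) = 10 (K+1) · expPS y K + y^(K+1).
expPS : ℕ → ℕ → ℕ
expPS y zero    = 1
expPS y (suc K) = 10 * suc K * expPS y K + y ^ suc K

-- For positive reals r:  e^{y/10} > r  iff  some partial sum of the series exceeds r.
-- ExpBound c n m  encodes  m / c > e^{-1.3} n^{1/(c+1)},  i.e. (raising to the
-- power c+1)  c^{c+1} · n < e^{1.3 (c+1)} · m^{c+1},  with 1.3 (c+1) = 13 (c+1) / 10.
ExpBound : ℕ → ℕ → ℕ → Set
ExpBound c n m = Σ ℕ λ K →
  c ^ suc c * n * (10 ^ K * K !) < m ^ suc c * expPS (13 * suc c) K

-- Count pairs (a, s) with a ∈ A and s ∈ B^c a sequence whose entries cover the
-- neighbourhood of a.  When c ≤ m, a set of at most c vertices is covered by at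
-- least c! of the m^c sequences, so there are at least n·c! = m^{c+1} such pairs
-- and some sequence s covers the neighbourhoods of m vertices.  A semi-matching of
-- those m vertices lands inside the c entries of s, so some b receives at least
-- m/c of them.  The numerical bound reduces to 2c^c ≤ (c+1)^c and
-- c·10^{c+1} < 2·13^{c+1}.
module Submission where

open import Defs
open import Data.Nat
  using (ℕ; zero; suc; _+_; _*_; _^_; _≤_; _<_; z≤n; s≤s; s≤s⁻¹; _<?_; NonZero; >-nonZero)
open import Data.Nat.Base using (_!)
open import Data.Nat.Properties
open import Data.Nat.Solver using (module +-*-Solver)
open import Algebra.Properties.CommutativeMonoid.Sum +-0-commutativeMonoid
  using (sum; sum-syntax; ∑-comm; sum-cong-≗)
open import Data.Fin using (Fin; zero; suc)
open import Data.Fin.Properties using (all?; any?) renaming (_≟_ to _≟ᶠ_)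
open import Data.Fin.Subset using (Subset; inside; outside; ⊥; ∣_∣; _-_; ⁅_⁆; _∈_)
open import Data.Fin.Subset.Properties
  using (_∈?_; ∉⊥; ∣⊥∣≡0; x∈p⇒∣p-x∣<∣p∣; x∈p∧x≢y⇒x∈p-y; ∣⁅x⁆∣≡1; x∈⁅y⁆⇒x≡y)
open import Data.Vec.Base using ([]; _∷_; here; there)
open import Data.Vec.Functional as Vector using (Vector)
open import Data.List using (filter; length; tabulate)
open import Data.List.Relation.Unary.Any as Any using ()
open import Data.List.Properties using (foldr-preservesᵒ)
open import Data.List.Membership.Propositional.Properties using (∈-map⁺; ∈-allFin)
open import Data.Product using (Σ; _×_; _,_; proj₁; proj₂; ∃)
import Data.Product as Product
open import Data.Sum using (inj₂; [_,_]; [_,_]′)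
open import Data.Unit using (tt)
open import Function using (_∘_; id)
open import Relation.Nullary using (Dec; yes; no; _×-dec_; _→-dec_; contradiction)
open import Relation.Nullary.Decidable using (toWitness)
open import Relation.Unary using (Pred; Decidable)
open import Relation.Binary.PropositionalEquality using (_≡_; refl; sym; trans; cong; subst)
open +-*-Solver

iverson : ∀ {p} {P : Set p} → Dec P → ℕ
iverson (yes _) = 1
iverson (no _)  = 0

P⇒1≤iverson : ∀ {p} {P : Set p} (d : Dec P) → P → 1 ≤ iverson d
P⇒1≤iverson (yes _) _ = ≤-refl
P⇒1≤iverson (no ¬p) p = contradiction p ¬p

iverson-mono : ∀ {p q} {P : Set p} {Q : Set q} (d : Dec P) (e : Dec Q) →
               (P → Q) → iverson d ≤ iverson e
iverson-mono (no _)  _       _ = z≤n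
iverson-mono (yes _) (yes _) _ = ≤-refl
iverson-mono (yes p) (no ¬q) f = contradiction (f p) ¬q

∑-mono-≤ : ∀ {n} {f g : Fin n → ℕ} → (∀ i → f i ≤ g i) → sum f ≤ sum g
∑-mono-≤ {zero}  _   = z≤n
∑-mono-≤ {suc n} f≤g = +-mono-≤ (f≤g zero) (∑-mono-≤ (f≤g ∘ suc))

∑-const : ∀ n k → ∑[ i < n ] k ≡ n * k
∑-const zero    k = refl
∑-const (suc n) k = cong (k +_) (∑-const n k)

∑≤n*k : ∀ {n k} {f : Fin n → ℕ} → (∀ i → f i ≤ k) → sum f ≤ n * k
∑≤n*k {n} {k} f≤k = ≤-trans (∑-mono-≤ f≤k) (≤-reflexive (∑-const n k))

n*k≤∑ : ∀ {n k} {f : Fin n → ℕ} → (∀ i → k ≤ f i) → n * k ≤ sum f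
n*k≤∑ {n} {k} k≤f = ≤-trans (≤-reflexive (sym (∑-const n k))) (∑-mono-≤ k≤f)

∣p∣*k≤∑ : ∀ {n k} (p : Subset n) {f : Fin n → ℕ} → (∀ i → i ∈ p → k ≤ f i) →
          ∣ p ∣ * k ≤ sum f
∣p∣*k≤∑ []            _   = z≤n
∣p∣*k≤∑ (inside ∷ p)  k≤f =
  +-mono-≤ (k≤f zero here) (∣p∣*k≤∑ p (λ i → k≤f (suc i) ∘ there))
∣p∣*k≤∑ (outside ∷ p) {f} k≤f =
  ≤-trans (∣p∣*k≤∑ p (λ i → k≤f (suc i) ∘ there)) (m≤n+m _ (f zero))

f≤∑ : ∀ {n} (f : Fin n → ℕ) i → f i ≤ sum f
f≤∑ f zero    = m≤m+n _ _
f≤∑ f (suc i) = ≤-trans (f≤∑ (f ∘ suc) i) (m≤n+m _ _)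

∑-pigeonhole : ∀ {n k} (f : Fin (suc n) → ℕ) → suc n * k ≤ sum f → ∃ λ i → k ≤ f i
∑-pigeonhole {zero}  {k} f k≤f₀ = zero , +-cancelʳ-≤ 0 k (f zero) k≤f₀
∑-pigeonhole {suc n} {k} f le   = [ (λ k≤f₀ → zero , k≤f₀) , inTail ]′ (≤-<-connex k (f zero))
  where
  inTail : f zero < k → ∃ λ i → k ≤ f i
  inTail f₀<k = Product.map suc id (∑-pigeonhole (f ∘ suc)
    (+-cancelˡ-≤ k _ _ (≤-trans le (+-monoˡ-≤ _ (<⇒≤ f₀<k)))))

length-filter-tabulate : ∀ {a p} {A : Set a} {P : Pred A p} (P? : Decidable P)
                         {n} (f : Fin n → A) →
                         length (filter P? (tabulate f)) ≡ ∑[ i < n ] iverson (P? (f i))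
length-filter-tabulate P? {zero}  f = refl
length-filter-tabulate P? {suc n} f with P? (f zero)
... | yes _ = cong suc (length-filter-tabulate P? (f ∘ suc))
... | no  _ = length-filter-tabulate P? (f ∘ suc)

∑Seq : ∀ m c → (Vector (Fin m) c → ℕ) → ℕ
∑Seq m zero    g = g Vector.[]
∑Seq m (suc c) g = ∑[ b < m ] ∑Seq m c (λ s → g (b Vector.∷ s))

∑Seq-mono-≤ : ∀ m c {g h : Vector (Fin m) c → ℕ} → (∀ s → g s ≤ h s) →
              ∑Seq m c g ≤ ∑Seq m c h
∑Seq-mono-≤ m zero    g≤h = g≤h Vector.[]
∑Seq-mono-≤ m (suc c) g≤h = ∑-mono-≤ (λ b → ∑Seq-mono-≤ m c (λ s → g≤h (b Vector.∷ s)))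

∑Seq-∑-comm : ∀ m c {n} (h : Vector (Fin m) c → Fin n → ℕ) →
              ∑Seq m c (λ s → ∑[ a < n ] h s a) ≡ ∑[ a < n ] ∑Seq m c (λ s → h s a)
∑Seq-∑-comm m zero    h = refl
∑Seq-∑-comm m (suc c) h = trans
  (sum-cong-≗ (λ b → ∑Seq-∑-comm m c (λ s → h (b Vector.∷ s))))
  (∑-comm (λ b a → ∑Seq m c (λ s → h (b Vector.∷ s) a)))

∑Seq-pigeonhole : ∀ m c {k} (g : Vector (Fin m) c → ℕ) → 1 ≤ m → m ^ c * k ≤ ∑Seq m c g →
                  ∃ λ s → k ≤ g s
∑Seq-pigeonhole m       zero    {k} g _   le =
  Vector.[] , ≤-trans (≤-reflexive (sym (+-identityʳ k))) le
∑Seq-pigeonhole (suc m) (suc c) {k} g 1≤m le =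
  let b , b-heavy = ∑-pigeonhole (λ b → ∑Seq (suc m) c (λ s → g (b Vector.∷ s)))
                      (≤-trans (≤-reflexive (sym (*-assoc (suc m) (suc m ^ c) k))) le)
      s , s-heavy = ∑Seq-pigeonhole (suc m) c (λ s → g (b Vector.∷ s)) 1≤m b-heavy
  in b Vector.∷ s , s-heavy

_covers_ : ∀ {m c} → Vector (Fin m) c → Subset m → Set
s covers N = ∀ b → b ∈ N → ∃ λ j → s j ≡ b

_covers?_ : ∀ {m c} (s : Vector (Fin m) c) (N : Subset m) → Dec (s covers N)
s covers? N = all? (λ b → b ∈? N →-dec any? (λ j → s j ≟ᶠ b))

#covering : ∀ m c → Subset m → ℕ
#covering m c N = ∑Seq m c (λ s → iverson (s covers? N))

∷-covers : ∀ {m c} x {s : Vector (Fin m) c} {N} → s covers N → (x Vector.∷ s) covers N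
∷-covers x cov b b∈N = Product.map suc id (cov b b∈N)

∷-covers-minus : ∀ {m c} x {s : Vector (Fin m) c} {N} →
                 s covers (N - x) → (x Vector.∷ s) covers N
∷-covers-minus x cov b b∈N with b ≟ᶠ x
... | yes b≡x = zero , sym b≡x
... | no  b≢x = Product.map suc id (cov b (x∈p∧x≢y⇒x∈p-y b∈N b≢x))

#covering-∷ : ∀ {m c} x {N′ N : Subset m} →
              (∀ {s : Vector (Fin m) c} → s covers N′ → (x Vector.∷ s) covers N) →
              #covering m c N′ ≤ ∑Seq m c (λ s → iverson ((x Vector.∷ s) covers? N))
#covering-∷ {m} {c} x {N′} {N} ext =
  ∑Seq-mono-≤ m c (λ s → iverson-mono (s covers? N′) ((x Vector.∷ s) covers? N) ext)

-- Choose the first entry: any b if ∣ N ∣ ≤ c, any b ∈ N if ∣ N ∣ = c + 1.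
c!≤#covering : ∀ {m} c (N : Subset m) → ∣ N ∣ ≤ c → c ≤ m → c ! ≤ #covering m c N
c!≤#covering zero N ∣N∣≤0 _ = P⇒1≤iverson (Vector.[] covers? N)
  (λ b b∈N → contradiction (≤-trans (x∈p⇒∣p-x∣<∣p∣ b∈N) ∣N∣≤0) λ ())
c!≤#covering {m} (suc c) N ∣N∣≤1+c 1+c≤m = [ notFull , full ]′ (m≤n⇒m<n∨m≡n ∣N∣≤1+c)
  where
  open ≤-Reasoning
  c≤m = <⇒≤ 1+c≤m

  notFull : ∣ N ∣ < suc c → suc c ! ≤ #covering m (suc c) N
  notFull ∣N∣≤c = begin
    suc c * c !  ≤⟨ *-monoˡ-≤ (c !) 1+c≤m ⟩
    m * c !      ≤⟨ n*k≤∑ (λ x → ≤-trans (c!≤#covering c N (s≤s⁻¹ ∣N∣≤c) c≤m)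
                                          (#covering-∷ {c = c} x (∷-covers x))) ⟩
    #covering m (suc c) N  ∎

  full : ∣ N ∣ ≡ suc c → suc c ! ≤ #covering m (suc c) N
  full ∣N∣≡1+c = begin
    suc c * c !  ≡⟨ cong (_* c !) (sym ∣N∣≡1+c) ⟩
    ∣ N ∣ * c !  ≤⟨ ∣p∣*k≤∑ N (λ x x∈N → ≤-trans (c!≤#covering c (N - x) (∣N-x∣≤c x∈N) c≤m)
                                                 (#covering-∷ {c = c} x (∷-covers-minus x))) ⟩
    #covering m (suc c) N  ∎
    where
    ∣N-x∣≤c : ∀ {x} → x ∈ N → ∣ N - x ∣ ≤ c
    ∣N-x∣≤c x∈N = s≤s⁻¹ (≤-trans (x∈p⇒∣p-x∣<∣p∣ x∈N) (≤-reflexive ∣N∣≡1+c))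

subset-of-size : ∀ {n p} {P : Pred (Fin n) p} (P? : Decidable P) k →
                 k ≤ ∑[ a < n ] iverson (P? a) →
                 Σ (Subset n) λ X → ∣ X ∣ ≡ k × (∀ a → a ∈ X → P a)
subset-of-size {n} P? zero _ = ⊥ , ∣⊥∣≡0 n , λ a a∈⊥ → contradiction a∈⊥ ∉⊥
subset-of-size {zero} P? (suc k) ()
subset-of-size {suc n} P? (suc k) le with P? zero
... | yes P₀ = let X , ∣X∣≡k , X⊆P = subset-of-size (P? ∘ suc) k (s≤s⁻¹ le)
               in inside ∷ X , cong suc ∣X∣≡k , λ { zero _ → P₀ ; (suc a) (there a∈X) → X⊆P a a∈X }
... | no  _  = let X , ∣X∣≡k , X⊆P = subset-of-size (P? ∘ suc) (suc k) le
               in outside ∷ X , ∣X∣≡k , λ { (suc a) (there a∈X) → X⊆P a a∈X }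

degT≤degMax : ∀ {n m} {X : Subset n} {F : Fin n → Subset m} (T : SemiMatching X F) b →
              degT T b ≤ degMax T
degT≤degMax T b = foldr-preservesᵒ (λ x y → [ m≤n⇒m≤n⊔o y , m≤n⇒m≤o⊔n x ]) 0 _
  (inj₂ (Any.map ≤-reflexive (∈-map⁺ (degT T) (∈-allFin b))))

-- Count the pairs (a, j) with a ∈ X and T a = s j in both orders.
∣X∣≤k*degMax : ∀ {n m k} {X : Subset n} {F : Fin n → Subset m}
               (T : SemiMatching X F) (s : Vector (Fin m) k) →
               (∀ a → a ∈ X → ∃ λ j → s j ≡ proj₁ T a) → ∣ X ∣ ≤ k * degMax T
∣X∣≤k*degMax {n} {m} {k} {X} T s hits = begin
  ∣ X ∣                                           ≡⟨ sym (*-identityʳ _) ⟩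
  ∣ X ∣ * 1                                       ≤⟨ ∣p∣*k≤∑ X oneHit ⟩
  ∑[ a < n ] ∑[ j < k ] iverson (matched a (s j)) ≡⟨ ∑-comm (λ a j → iverson (matched a (s j))) ⟩
  ∑[ j < k ] ∑[ a < n ] iverson (matched a (s j)) ≡⟨ sum-cong-≗ (λ j → sym (degT-as-∑ (s j))) ⟩
  ∑[ j < k ] degT T (s j)                         ≤⟨ ∑≤n*k (λ j → degT≤degMax T (s j)) ⟩
  k * degMax T                                    ∎
  where
  open ≤-Reasoning
  matched : ∀ a b → Dec (a ∈ X × proj₁ T a ≡ b)
  matched a b = (a ∈? X) ×-dec (proj₁ T a ≟ᶠ b)
  degT-as-∑ : ∀ b → degT T b ≡ ∑[ a < n ] iverson (matched a b)
  degT-as-∑ b = length-filter-tabulate (λ a → matched a b) id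
  oneHit : ∀ a → a ∈ X → 1 ≤ ∑[ j < k ] iverson (matched a (s j))
  oneHit a a∈X = let j , sⱼ≡Ta = hits a a∈X in
    ≤-trans (P⇒1≤iverson (matched a (s j)) (a∈X , sym sⱼ≡Ta))
            (f≤∑ (λ j → iverson (matched a (s j))) j)

common-cover : ∀ {c n m} (F : Fin n → Subset m) → (∀ a → ∣ F a ∣ ≤ c) → c ≤ m → 1 ≤ m →
               m ^ suc c ≤ c ! * n →
               ∃ λ (s : Vector (Fin m) c) → m ≤ ∑[ a < n ] iverson (s covers? F a)
common-cover {c} {n} {m} F ∣F∣≤c c≤m 1≤m m^[1+c]≤c!n = ∑Seq-pigeonhole m c _ 1≤m (begin
  m ^ c * m                       ≡⟨ *-comm (m ^ c) m ⟩
  m ^ suc c                       ≤⟨ m^[1+c]≤c!n ⟩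
  c ! * n                         ≡⟨ *-comm (c !) n ⟩
  n * c !                         ≤⟨ n*k≤∑ (λ a → c!≤#covering c (F a) (∣F∣≤c a) c≤m) ⟩
  ∑[ a < n ] #covering m c (F a)  ≡⟨ ∑Seq-∑-comm m c (λ s a → iverson (s covers? F a)) ⟨
  ∑Seq m c (λ s → ∑[ a < n ] iverson (s covers? F a))  ∎)
  where open ≤-Reasoning

1≤degMax-⁅a⁆ : ∀ {n m} {F : Fin n → Subset m} a (T : SemiMatching ⁅ a ⁆ F) → 1 ≤ degMax T
1≤degMax-⁅a⁆ a T = begin
  1                 ≡⟨ ∣⁅x⁆∣≡1 a ⟨
  ∣ ⁅ a ⁆ ∣         ≤⟨ ∣X∣≤k*degMax {k = 1} T (λ _ → proj₁ T a) hits ⟩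
  1 * degMax T      ≡⟨ *-identityˡ (degMax T) ⟩
  degMax T          ∎
  where
  open ≤-Reasoning
  hits : ∀ a′ → a′ ∈ ⁅ a ⁆ → ∃ λ (j : Fin 1) → proj₁ T a ≡ proj₁ T a′
  hits a′ a′∈⁅a⁆ = zero , cong (proj₁ T) (sym (x∈⁅y⁆⇒x≡y a a′∈⁅a⁆))

HardSubset : ∀ {n m} → (Fin n → Subset m) → ℕ → Set
HardSubset {n} {m} F c =
  Σ (Subset n) λ X → ∣ X ∣ ≤ m × (∀ (T : SemiMatching X F) → m ≤ c * degMax T)

-- For m ≤ c a single vertex already forces load 1 ≥ m / c.
hardSubset : ∀ {c n m} (F : Fin n → Subset m) → (∀ a → ∣ F a ∣ ≤ c) → 1 ≤ n → 1 ≤ m →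
             m ^ suc c ≤ c ! * n → HardSubset F c
hardSubset {c} {n@(suc _)} {m} F ∣F∣≤c _ 1≤m m^[1+c]≤c!n = [ small , large ]′ (≤-<-connex m c)
  where
  small : m ≤ c → HardSubset F c
  small m≤c = ⁅ zero ⁆ , ≤-trans (≤-reflexive (∣⁅x⁆∣≡1 {n} zero)) 1≤m , λ T → begin
    m             ≤⟨ m≤c ⟩
    c             ≡⟨ *-identityʳ c ⟨
    c * 1         ≤⟨ *-monoʳ-≤ c (1≤degMax-⁅a⁆ zero T) ⟩
    c * degMax T  ∎
    where open ≤-Reasoning

  large : c < m → HardSubset F c
  large c<m =
    let s , m≤#covered = common-cover F ∣F∣≤c (<⇒≤ c<m) 1≤m m^[1+c]≤c!n
        X , ∣X∣≡m , X-covered = subset-of-size (λ a → s covers? F a) m m≤#covered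
    in X , ≤-reflexive ∣X∣≡m , λ T → subst (_≤ c * degMax T) ∣X∣≡m
         (∣X∣≤k*degMax T s (λ a a∈X → X-covered a a∈X (proj₁ T a) (proj₂ T a a∈X)))

[m*n]^k≡m^k*n^k : ∀ m n k → (m * n) ^ k ≡ m ^ k * n ^ k
[m*n]^k≡m^k*n^k m n zero    = refl
[m*n]^k≡m^k*n^k m n (suc k) = trans (cong (m * n *_) ([m*n]^k≡m^k*n^k m n k))
  (solve 4 (λ m n x y → m :* n :* (x :* y) := m :* x :* (n :* y)) refl m n (m ^ k) (n ^ k))

c^k*[c+k]≤c*[1+c]^k : ∀ c k → c ^ k * (c + k) ≤ c * suc c ^ k
c^k*[c+k]≤c*[1+c]^k c zero    = ≤-reflexive (solve 1 (λ c → con 1 :* (c :+ con 0) := c :* con 1) refl c)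
c^k*[c+k]≤c*[1+c]^k c (suc k) = begin
  c * c ^ k * (c + suc k)
    ≡⟨ solve 3 (λ c x k → c :* x :* (c :+ (con 1 :+ k)) := c :* x :+ c :* (x :* (c :+ k)))
               refl c (c ^ k) k ⟩
  c * c ^ k + c * (c ^ k * (c + k))
    ≤⟨ +-monoˡ-≤ _ (≤-trans (≤-reflexive (*-comm c (c ^ k))) (*-monoʳ-≤ (c ^ k) (m≤m+n c k))) ⟩
  c ^ k * (c + k) + c * (c ^ k * (c + k))
    ≡⟨ solve 2 (λ c y → y :+ c :* y := (con 1 :+ c) :* y) refl c (c ^ k * (c + k)) ⟩
  suc c * (c ^ k * (c + k))
    ≤⟨ *-monoʳ-≤ (suc c) (c^k*[c+k]≤c*[1+c]^k c k) ⟩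
  suc c * (c * suc c ^ k)
    ≡⟨ solve 3 (λ c r s → s :* (c :* r) := c :* (s :* r)) refl c (suc c ^ k) (suc c) ⟩
  c * suc c ^ suc k  ∎
  where open ≤-Reasoning

2*c^c≤[1+c]^c : ∀ c → 1 ≤ c → 2 * c ^ c ≤ suc c ^ c
2*c^c≤[1+c]^c c@(suc _) _ = *-cancelˡ-≤ c (begin
  c * (2 * c ^ c)  ≡⟨ solve 2 (λ c x → c :* (con 2 :* x) := x :* (c :+ c)) refl c (c ^ c) ⟩
  c ^ c * (c + c)  ≤⟨ c^k*[c+k]≤c*[1+c]^k c c ⟩
  c * suc c ^ c    ∎)
  where open ≤-Reasoning

-- The ratio of consecutive terms is at most 13/10 from c = 4 on.
c*10^[1+c]<2*13^[1+c] : ∀ c → c * 10 ^ suc c < 2 * 13 ^ suc c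
c*10^[1+c]<2*13^[1+c] 0 = toWitness {a? = 0 * 10 ^ 1 <? 2 * 13 ^ 1} tt
c*10^[1+c]<2*13^[1+c] 1 = toWitness {a? = 1 * 10 ^ 2 <? 2 * 13 ^ 2} tt
c*10^[1+c]<2*13^[1+c] 2 = toWitness {a? = 2 * 10 ^ 3 <? 2 * 13 ^ 3} tt
c*10^[1+c]<2*13^[1+c] 3 = toWitness {a? = 3 * 10 ^ 4 <? 2 * 13 ^ 4} tt
c*10^[1+c]<2*13^[1+c] 4 = toWitness {a? = 4 * 10 ^ 5 <? 2 * 13 ^ 5} tt
c*10^[1+c]<2*13^[1+c] (suc (suc (suc (suc (suc k))))) = begin-strict
  (5 + k) * (10 * p)       ≡⟨ solve 2 (λ k p → (con 5 :+ k) :* (con 10 :* p) := (con 50 :+ con 10 :* k) :* p)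
                                      refl k p ⟩
  (50 + 10 * k) * p        ≤⟨ *-monoˡ-≤ p (+-mono-≤ (m≤m+n 50 2) (*-monoˡ-≤ k (m≤m+n 10 3))) ⟩
  (52 + 13 * k) * p        ≡⟨ solve 2 (λ k p → (con 52 :+ con 13 :* k) :* p := con 13 :* ((con 4 :+ k) :* p))
                                      refl k p ⟩
  13 * ((4 + k) * p)       <⟨ *-monoʳ-< 13 (c*10^[1+c]<2*13^[1+c] (suc (suc (suc (suc k))))) ⟩
  13 * (2 * 13 ^ (5 + k))  ≡⟨ solve 2 (λ q t → t :* (con 2 :* q) := con 2 :* (t :* q)) refl (13 ^ (5 + k)) 13 ⟩
  2 * 13 ^ (6 + k)         ∎
  where
  open ≤-Reasoning
  p = 10 ^ (5 + k)

-- With K = c + 1 only the top term (13(c+1))^{c+1} of expPS is needed.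
expBound : ∀ c n m → 1 ≤ c → 1 ≤ n → m ^ suc c ≡ c ! * n → ExpBound c n m
expBound c n m 1≤c 1≤n m^[1+c]≡c!n = suc c , (begin-strict
  c ^ suc c * n * (10 ^ suc c * suc c !)
    ≡⟨ solve 5 (λ c a n p f → c :* a :* n :* (p :* ((con 1 :+ c) :* f))
                            := c :* p :* (a :* n :* (con 1 :+ c) :* f))
               refl c (c ^ c) n (10 ^ suc c) (c !) ⟩
  c * 10 ^ suc c * z
    <⟨ *-monoˡ-< z (c*10^[1+c]<2*13^[1+c] c) ⟩
  2 * 13 ^ suc c * z
    ≡⟨ solve 5 (λ c a n q f → con 2 :* q :* (a :* n :* (con 1 :+ c) :* f)
                            := f :* n :* (q :* ((con 1 :+ c) :* (con 2 :* a))))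
               refl c (c ^ c) n (13 ^ suc c) (c !) ⟩
  c ! * n * (13 ^ suc c * (suc c * (2 * c ^ c)))
    ≤⟨ *-monoʳ-≤ (c ! * n) (*-monoʳ-≤ (13 ^ suc c) (*-monoʳ-≤ (suc c) (2*c^c≤[1+c]^c c 1≤c))) ⟩
  c ! * n * (13 ^ suc c * suc c ^ suc c)
    ≡⟨ cong (c ! * n *_) ([m*n]^k≡m^k*n^k 13 (suc c) (suc c)) ⟨
  c ! * n * (13 * suc c) ^ suc c
    ≤⟨ *-monoʳ-≤ (c ! * n) (m≤n+m ((13 * suc c) ^ suc c) (10 * suc c * expPS (13 * suc c) c)) ⟩
  c ! * n * expPS (13 * suc c) (suc c)
    ≡⟨ cong (_* expPS (13 * suc c) (suc c)) m^[1+c]≡c!n ⟨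
  m ^ suc c * expPS (13 * suc c) (suc c)  ∎)
  where
  open ≤-Reasoning
  z = c ^ c * n * suc c * c !
  instance
    c≢0 : NonZero c
    c≢0 = >-nonZero 1≤c
    z≢0 : NonZero z
    z≢0 = >-nonZero (*-mono-≤ (*-mono-≤ (*-mono-≤ (m^n>0 c c) 1≤n) (s≤s z≤n)) (1≤n! c))

1≤m^[1+k]⇒1≤m : ∀ m k → 1 ≤ m ^ suc k → 1 ≤ m
1≤m^[1+k]⇒1≤m zero    k ()
1≤m^[1+k]⇒1≤m (suc m) k _ = s≤s z≤n

lemma10 : (c n m : ℕ) → 1 ≤ c → 1 ≤ n → m ^ suc c ≡ c ! * n →
          (E' : Fin n → Subset m) → (∀ a → degA E' a ≤ c) →
          Σ (Subset n) λ A' → ∣ A' ∣ ≤ m ×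
            (∀ (T : SemiMatching A' E') → m ≤ c * degMax T) ×
            ExpBound c n m
lemma10 c n m 1≤c 1≤n m^[1+c]≡c!n E' deg≤c =
  let A' , ∣A'∣≤m , load = hardSubset E' deg≤c 1≤n 1≤m (≤-reflexive m^[1+c]≡c!n)
  in A' , ∣A'∣≤m , load , expBound c n m 1≤c 1≤n m^[1+c]≡c!n
  where
  1≤m = 1≤m^[1+k]⇒1≤m m c (≤-trans (*-mono-≤ (1≤n! c) 1≤n) (≤-reflexive (sym m^[1+c]≡c!n)))
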